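{- For all integers $1\le n \le q$, \begin{equation*} \Delta(x_n) = 1\otimes x_n + x_n \otimes 1. \end{equation*}
   Context: Let $\mathbb F_q$ be the finite field with $q$ elements, of characteristic $p$. Let $\Sigma=\{x_n\}_{n\geq 1}$ be an alphabet with weight $w(x_n)=n$; let $\langle\Sigma\rangle$ be the set of words over $\Sigma$ (the empty word is denoted $1$; the weight of a word is the sum of the weights of its letters), and let $\mathfrak C=\mathbb F_q\langle\Sigma\rangle$ be the $\mathbb F_q$-vector space with basis $\langle\Sigma\rangle$. A nonempty word is written $\mathfrak a=x_a\mathfrak a_-$. For $a,b,i\in\mathbb N$ put $\Delta^i_{a,b}=(-1)^{a-1}\binom{i-1}{a-1}+(-1)^{b-1}\binom{i-1}{b-1}\in\mathbb F_p$ if $(q-1)\mid i$ and $0<i<a+b$, and $\Delta^i_{a,b}=0$ otherwise. Define $\mathbb F_q$-bilinear products $\diamond$ (diamond) and $\sqcup\!\sqcup$ (shuffle) on $\mathfrak C$ recursively by $1\diamond\mathfrak a=\mathfrak a\diamond 1=\mathfrak a$, $1\sqcup\!\sqcup\mathfrak a=\mathfrak a\sqcup\!\sqcup 1=\mathfrak a$, and for nonempty words $\mathfrak a,\mathfrak b$: $\mathfrak a\diamond\mathfrak b=x_{a+b}(\mathfrak a_-\sqcup\!\sqcup\mathfrak b_-)+\sum_{i+j=a+b}\Delta^j_{a,b}\,x_i(x_j\sqcup\!\sqcup(\mathfrak a_-\sqcup\!\sqcup\mathfrak b_-))$, $\mathfrak a\sqcup\!\sqcup\mathfrak b=x_a(\mathfrak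 a_-\sqcup\!\sqcup\mathfrak b)+x_b(\mathfrak a\sqcup\!\sqcup\mathfrak b_-)+\mathfrak a\diamond\mathfrak b$. The triangle product is $1\triangleright\mathfrak a=\mathfrak a\triangleright 1=\mathfrak a$ and $\mathfrak a\triangleright\mathfrak b=x_a(\mathfrak a_-\sqcup\!\sqcup\mathfrak b)$ for nonempty $\mathfrak a,\mathfrak b$. On $\mathfrak C\otimes\mathfrak C$ the shuffle product is taken componentwise. The coproduct $\Delta:\mathfrak C\to\mathfrak C\otimes\mathfrak C$ is the $\mathbb F_q$-linear map defined on words by induction on weight: $\Delta(1)=1\otimes 1$, $\Delta(x_1)=1\otimes x_1+x_1\otimes 1$; if $\mathfrak u=x_u\mathfrak v$ has depth $>1$ and $\Delta(x_u)=1\otimes x_u+\sum a_u\otimes b_u$, $\Delta(\mathfrak v)=\sum a_{\mathfrak v}\otimes b_{\mathfrak v}$, then $\Delta(\mathfrak u)=1\otimes\mathfrak u+\sum(a_u\triangleright a_{\mathfrak v})\otimes(b_u\sqcup\!\sqcup b_{\mathfrak v})$; and for $w\geq 2$, $\Delta(x_w)=\Delta(x_1)\sqcup\!\sqcup\Delta(x_{w-1})-\Delta(x_1x_{w-1})-\Delta(x_{w-1}x_1)-\sum_{0<j<w}\Delta^j_{1,w-1}\Delta(x_{w-j}x_j)$. -}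

module Defs where

open import Data.Nat as ℕ using (ℕ; zero; suc; _∸_)
open import Data.Nat.Divisibility using (_∣?_)
open import Data.Nat.Combinatorics using (_C_)
open import Data.Integer as ℤ using (ℤ; +_; -_)
open import Data.Integer.Divisibility as ℤD using ()
open import Data.List using (List; []; _∷_; [_]; _++_; map; concatMap; length; upTo)
open import Data.List.Properties using (≡-dec)
open import Data.Product using (_×_; _,_)
open import Data.Bool using (Bool; true; false; if_then_else_; _∧_)
open import Relation.Nullary using (does)

-- Letters: the letter x_n is represented by the natural number n (only n ≥ 1
-- are genuine letters; x_0 never arises from genuine inputs).
Word : Set
Word = List ℕ

weight : Word → ℕ
weight [] = 0
weight (n ∷ w) = n ℕ.+ weight w

-- Elements of 𝔉_p⟨Σ⟩ as formal ℤ-linear combinations of words (coefficients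
-- are read modulo p, see _≈[_]_ below).
Lin : Set
Lin = List (ℤ × Word)

-- Elements of 𝔉_p⟨Σ⟩ ⊗ 𝔉_p⟨Σ⟩ as formal ℤ-linear combinations of pairs of words.
Ten : Set
Ten = List (ℤ × Word × Word)

scale : ℤ → Lin → Lin
scale c = map (λ { (d , w) → (c ℤ.* d , w) })

scaleT : ℤ → Ten → Ten
scaleT c = map (λ { (d , a , b) → (c ℤ.* d , a , b) })

pre : ℕ → Lin → Lin
pre a = map (λ { (d , w) → (d , a ∷ w) })

-- sum over j = 1 .. m-1 (i.e. 0 < j < m)
sumL : (ℕ → Lin) → ℕ → Lin
sumL f m = concatMap (λ j → f (suc j)) (upTo (m ∸ 1))

sumT : (ℕ → Ten) → ℕ → Ten
sumT f m = concatMap (λ j → f (suc j)) (upTo (m ∸ 1))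

sgn : ℕ → ℤ
sgn zero = + 1
sgn (suc k) = - sgn k

Dlt : (q i a b : ℕ) → ℤ
Dlt q i a b =
  if does ((q ∸ 1) ∣? i) ∧ (does (0 ℕ.<? i) ∧ does (i ℕ.<? a ℕ.+ b))
  then sgn (a ∸ 1) ℤ.* (+ ((i ∸ 1) C (a ∸ 1))) ℤ.+ sgn (b ∸ 1) ℤ.* (+ ((i ∸ 1) C (b ∸ 1)))
  else + 0

-- Shuffle and diamond with a fuel argument (fuel ≥ depth(𝔞) + depth(𝔟) suffices;
-- the recursion of the paper decreases the total depth).
mutual
  sh : ℕ → ℕ → Word → Word → Lin
  sh q _ [] b = [ (+ 1 , b) ]
  sh q _ (a ∷ as) [] = [ (+ 1 , a ∷ as) ]
  sh q zero (a ∷ as) (b ∷ bs) = []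
  sh q (suc f) (a ∷ as) (b ∷ bs) =
    pre a (sh q f as (b ∷ bs)) ++ pre b (sh q f (a ∷ as) bs) ++ dm q f (a ∷ as) (b ∷ bs)

  shLetterL : ℕ → ℕ → ℕ → Lin → Lin
  shLetterL q f j [] = []
  shLetterL q f j ((c , v) ∷ L) = scale c (sh q f [ j ] v) ++ shLetterL q f j L

  dm : ℕ → ℕ → Word → Word → Lin
  dm q f [] b = [ (+ 1 , b) ]
  dm q f (a ∷ as) [] = [ (+ 1 , a ∷ as) ]
  dm q f (a ∷ as) (b ∷ bs) =
    pre (a ℕ.+ b) (sh q f as bs)
    ++ sumL (λ j → scale (Dlt q j a b) (pre (a ℕ.+ b ∸ j) (shLetterL q f j (sh q f as bs)))) (a ℕ.+ b)

shuffle : ℕ → Word → Word → Lin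
shuffle q a b = sh q (length a ℕ.+ length b) a b

diamond : ℕ → Word → Word → Lin
diamond q a b = dm q (length a ℕ.+ length b) a b

triangle : ℕ → Word → Word → Lin
triangle q [] b = [ (+ 1 , b) ]
triangle q (a ∷ as) [] = [ (+ 1 , a ∷ as) ]
triangle q (a ∷ as) b = pre a (shuffle q as b)

bilin : (Word → Word → Lin) → Lin → Lin → Lin
bilin m L M = concatMap (λ { (c , u) → concatMap (λ { (d , v) → scale (c ℤ.* d) (m u v) }) M }) L

tensor : Lin → Lin → Ten
tensor L M = concatMap (λ { (c , u) → map (λ { (d , v) → (c ℤ.* d , u , v) }) M }) L

shuffleT : ℕ → Ten → Ten → Ten
shuffleT q S T = concatMap (λ { (c , a₁ , b₁) → concatMap (λ { (d , a₂ , b₂) →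
  scaleT (c ℤ.* d) (tensor (shuffle q a₁ a₂) (shuffle q b₁ b₂)) }) T }) S

combine : ℕ → Ten → Ten → Ten
combine q S T = concatMap (λ { (c , a₁ , b₁) → concatMap (λ { (d , a₂ , b₂) →
  scaleT (c ℤ.* d) (tensor (triangle q a₁ a₂) (shuffle q b₁ b₂)) }) T }) S

negT : Ten → Ten
negT = scaleT (- (+ 1))

cop : ℕ → ℕ → Word → Ten
cop q _ [] = [ (+ 1 , [] , []) ]
cop q zero (_ ∷ _) = []
cop q (suc f) (zero ∷ []) = (+ 1 , [] , [ 0 ]) ∷ (+ 1 , [ 0 ] , []) ∷ []   -- x_0 is not a letter; irrelevant
cop q (suc f) (suc zero ∷ []) = (+ 1 , [] , [ 1 ]) ∷ (+ 1 , [ 1 ] , []) ∷ []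
cop q (suc f) (suc (suc k) ∷ []) =
  let w = suc (suc k) in
  shuffleT q (cop q f [ 1 ]) (cop q f [ w ∸ 1 ])
  ++ negT (cop q f (1 ∷ (w ∸ 1) ∷ []))
  ++ negT (cop q f ((w ∸ 1) ∷ 1 ∷ []))
  ++ negT (sumT (λ j → scaleT (Dlt q j 1 (w ∸ 1)) (cop q f ((w ∸ j) ∷ j ∷ []))) w)
cop q (suc f) (u ∷ v ∷ vs) =
  (+ 1 , [] , u ∷ v ∷ vs)
  ∷ combine q (cop q f [ u ] ++ [ (- (+ 1) , [] , [ u ]) ]) (cop q f (v ∷ vs))

-- The coproduct Δ : 𝔠 → 𝔠 ⊗ 𝔠 on words (fuel 2·weight + depth + 1 is sufficient).
coproduct : ℕ → Word → Ten
coproduct q w = cop q (2 ℕ.* weight w ℕ.+ length w ℕ.+ 1) w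

coeffT : Ten → Word → Word → ℤ
coeffT [] a b = + 0
coeffT ((c , u , v) ∷ T) a b =
  (if does (≡-dec ℕ._≟_ u a) ∧ does (≡-dec ℕ._≟_ v b) then c else + 0) ℤ.+ coeffT T a b

_≈[_]_ : Ten → ℕ → Ten → Set
S ≈[ p ] T = ∀ a b → (+ p) ℤD.∣ (coeffT S a b ℤ.- coeffT T a b)

-- For 2 ≤ n ≤ q the
-- recursive definition of Δ(x_n) involves only the coefficients Δ^j_{1,n-1}
-- with 0 < j < n ≤ q, which vanish in 𝔽_p: the only candidate is j = q - 1 = n - 1,
-- where the coefficient is 1 + (-1)^q, i.e. 0 for odd q and 2 = 0 for p = 2.
-- The same coefficients make x_1 ⧢ x_{n-1} = x_1 x_{n-1} + x_{n-1} x_1 + x_n.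
-- By induction x_1 and x_{n-1} are primitive, so Δ(x_1 x_{n-1}) and Δ(x_{n-1} x_1)
-- are the deconcatenation coproducts, and expanding Δ(x_1) ⧢ Δ(x_{n-1}) everything
-- cancels except 1 ⊗ x_n + x_n ⊗ 1.  Equalities in 𝔽_p⟨Σ⟩ ⊗ 𝔽_p⟨Σ⟩ are checked by
-- applying arbitrary ℤ-valued linear functionals and comparing modulo p.
module Submission where

open import Defs
open import Data.Nat as ℕ using (ℕ; zero; suc; _≤_; _<_; _^_; _∸_; z≤n; s≤s)
open import Data.Nat.Properties
  using (≤-antisym; ≤-trans; ≤-reflexive; ≤-pred; <⇒≤; m≤n⇒m≤1+n; m≤m+n; *-comm; +-identityʳ)
open import Data.Nat.Divisibility using (_∣_; _∣?_; ∣⇒≤; ∣-refl; ∣-reflexive; ∣m∣n⇒∣m+n; ∣1⇒≡1; _∣0)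
open import Data.Nat.Primality using (Prime; euclidsLemma; prime[2]; prime⇒irreducible)
open import Data.Nat.Combinatorics using (_C_; nCn≡1)
open import Data.Integer using (ℤ; +_; -_; _+_; _*_; _-_)
import Data.Integer.Properties as ℤ
open import Data.Integer.Divisibility.Signed as Signed using (divides; ∣ᵤ⇒∣; ∣⇒∣ᵤ)
open import Data.Integer.Tactic.RingSolver using (solve-∀)
open import Data.List using (List; []; _∷_; [_]; _++_; map; concatMap)
open import Data.List.Properties using (≡-dec; map-++; ++-identityʳ)
open import Data.List.Relation.Unary.All using (All; []; _∷_)
open import Data.List.Relation.Unary.All.Properties using (applyUpTo⁺₁)
open import Data.Bool using (Bool; true; false; if_then_else_; _∧_)
open import Data.Product using (_×_; _,_)
open import Data.Sum using (_⊎_; inj₁; inj₂; [_,_]′)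
open import Function using (_∘_; id)
open import Relation.Nullary using (Dec; yes; no; does)
open import Relation.Binary using (Setoid)
open import Relation.Binary.PropositionalEquality using (_≡_; refl; sym; trans; cong; cong₂; subst)
import Relation.Binary.Reasoning.Setoid as SetoidReasoning

private
  variable
    A B : Set

eval : (A → ℤ) → List (ℤ × A) → ℤ
eval g [] = + 0
eval g ((c , x) ∷ L) = c * g x + eval g L

basis : A → List (ℤ × A)
basis x = [ (+ 1 , x) ]

eval-basis : ∀ (g : A → ℤ) x → eval g (basis x) ≡ g x
eval-basis g x = trans (ℤ.+-identityʳ _) (ℤ.*-identityˡ (g x))

eval-++ : ∀ (g : A → ℤ) L M → eval g (L ++ M) ≡ eval g L + eval g M
eval-++ g [] M = sym (ℤ.+-identityˡ _)
eval-++ g ((c , x) ∷ L) M =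
  trans (cong (_+_ (c * g x)) (eval-++ g L M)) (sym (ℤ.+-assoc (c * g x) _ _))

eval-congˡ : ∀ {g h : A → ℤ} → (∀ x → g x ≡ h x) → ∀ L → eval g L ≡ eval h L
eval-congˡ g≡h [] = refl
eval-congˡ g≡h ((c , x) ∷ L) = cong₂ (λ u v → c * u + v) (g≡h x) (eval-congˡ g≡h L)

private
  pull-scalar : ∀ c d u r → d * (c * u) + c * r ≡ c * (d * u + r)
  pull-scalar = solve-∀

eval-*ˡ : ∀ c (g : A → ℤ) L → eval (λ x → c * g x) L ≡ c * eval g L
eval-*ˡ c g [] = sym (ℤ.*-zeroʳ c)
eval-*ˡ c g ((d , x) ∷ L) =
  trans (cong (_+_ (d * (c * g x))) (eval-*ˡ c g L)) (pull-scalar c d (g x) (eval g L))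

eval-map-scaled : ∀ (g : B → ℤ) c (f : A → B) {h : ℤ × A → ℤ × B} →
  (∀ d x → h (d , x) ≡ (c * d , f x)) → ∀ L → eval g (map h L) ≡ c * eval (g ∘ f) L
eval-map-scaled g c f h≡ [] = sym (ℤ.*-zeroʳ c)
eval-map-scaled g c f {h} h≡ ((d , x) ∷ L) rewrite h≡ d x =
  trans (cong (_+_ (c * d * g (f x))) (eval-map-scaled g c f {h} h≡ L))
        (trans (cong (_+ c * eval (g ∘ f) L) (ℤ.*-assoc c d (g (f x))))
               (sym (ℤ.*-distribˡ-+ c _ _)))

eval-concatMap : ∀ (g : B → ℤ) (H : A → ℤ) {h : ℤ × A → List (ℤ × B)} →
  (∀ c x → eval g (h (c , x)) ≡ c * H x) → ∀ L → eval g (concatMap h L) ≡ eval H L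
eval-concatMap g H h≡ [] = refl
eval-concatMap g H {h} h≡ ((c , x) ∷ L) =
  trans (eval-++ g (h (c , x)) (concatMap h L))
        (cong₂ _+_ (h≡ c x) (eval-concatMap g H h≡ L))

eval-scale : ∀ (g : Word → ℤ) c L → eval g (scale c L) ≡ c * eval g L
eval-scale g c = eval-map-scaled g c id (λ _ _ → refl)

eval-scaleT : ∀ (G : Word × Word → ℤ) c T → eval G (scaleT c T) ≡ c * eval G T
eval-scaleT G c = eval-map-scaled G c id (λ _ _ → refl)

scaleT-++ : ∀ c S T → scaleT c (S ++ T) ≡ scaleT c S ++ scaleT c T
scaleT-++ c = map-++ _

eval-tensor : ∀ (G : Word × Word → ℤ) L M →
  eval G (tensor L M) ≡ eval (λ u → eval (λ v → G (u , v)) M) L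
eval-tensor G L M =
  eval-concatMap G _ (λ c u → eval-map-scaled G c (u ,_) (λ _ _ → refl) M) L

eval-tensor-basisˡ : ∀ (G : Word × Word → ℤ) u M →
  eval G (tensor (basis u) M) ≡ eval (λ v → G (u , v)) M
eval-tensor-basisˡ G u M =
  trans (eval-tensor G (basis u) M) (eval-basis (λ u → eval (λ v → G (u , v)) M) u)

eval-tensor-basisʳ : ∀ (G : Word × Word → ℤ) L v →
  eval G (tensor L (basis v)) ≡ eval (λ u → G (u , v)) L
eval-tensor-basisʳ G L v =
  trans (eval-tensor G L (basis v)) (eval-congˡ (λ u → eval-basis (λ v → G (u , v)) v) L)

-- shuffleT q and combine q are definitionally bilinear (shuffle⊗ q) and bilinear (triangle⊗ q).
bilinear : (Word × Word → Word × Word → Ten) → Ten → Ten → Ten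
bilinear K S T = concatMap (λ (c , x) → concatMap (λ (d , y) → scaleT (c * d) (K x y)) T) S

shuffle⊗ triangle⊗ : ℕ → Word × Word → Word × Word → Ten
shuffle⊗ q (a₁ , b₁) (a₂ , b₂) = tensor (shuffle q a₁ a₂) (shuffle q b₁ b₂)
triangle⊗ q (a₁ , b₁) (a₂ , b₂) = tensor (triangle q a₁ a₂) (shuffle q b₁ b₂)

eval-bilinear : ∀ K (G : Word × Word → ℤ) S T →
  eval G (bilinear K S T) ≡ eval (λ x → eval (λ y → eval G (K x y)) T) S
eval-bilinear K G S T = eval-concatMap G _ row S
  where
  row : ∀ c x → eval G (concatMap (λ (d , y) → scaleT (c * d) (K x y)) T)
              ≡ c * eval (λ y → eval G (K x y)) T
  row c x = trans (eval-concatMap G (λ y → c * eval G (K x y)) entry T)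
                  (eval-*ˡ c (λ y → eval G (K x y)) T)
    where
    entry : ∀ d y → eval G (scaleT (c * d) (K x y)) ≡ d * (c * eval G (K x y))
    entry d y = trans (eval-scaleT G (c * d) (K x y))
                      (trans (cong (_* _) (ℤ.*-comm c d)) (ℤ.*-assoc d c _))

deconcatenation : Word → Ten
deconcatenation [] = basis ([] , [])
deconcatenation (x ∷ w) =
  basis ([] , x ∷ w) ++ map (λ (c , u , v) → (c , x ∷ u , v)) (deconcatenation w)

cop-pair-unfold : ∀ q f a b → cop q (suc f) (a ∷ b ∷ [])
  ≡ basis ([] , a ∷ b ∷ []) ++ combine q (cop q f [ a ] ++ negT (basis ([] , [ a ]))) (cop q f [ b ])
cop-pair-unfold q f zero b = refl
cop-pair-unfold q f (suc zero) b = refl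
cop-pair-unfold q f (suc (suc a)) b = refl

eval-deconcatenation-letter : ∀ (G : Word × Word → ℤ) a →
  eval G (deconcatenation [ a ]) ≡ G ([] , [ a ]) + G ([ a ] , [])
eval-deconcatenation-letter G a =
  cong₂ _+_ (ℤ.*-identityˡ (G ([] , [ a ]))) (eval-basis G ([ a ] , []))

eval-deconcatenation-pair : ∀ (G : Word × Word → ℤ) a b →
  eval G (deconcatenation (a ∷ b ∷ []))
    ≡ G ([] , a ∷ b ∷ []) + (G ([ a ] , [ b ]) + G (a ∷ b ∷ [] , []))
eval-deconcatenation-pair G a b =
  cong₂ _+_ (ℤ.*-identityˡ (G ([] , a ∷ b ∷ [])))
    (cong₂ _+_ (ℤ.*-identityˡ (G ([ a ] , [ b ]))) (eval-basis G (a ∷ b ∷ [] , [])))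

eval-shuffleT-letters : ∀ q (G : Word × Word → ℤ) a b →
  eval G (shuffleT q (deconcatenation [ a ]) (deconcatenation [ b ]))
    ≡ (eval (λ v → G ([] , v)) (shuffle q [ a ] [ b ]) + G ([ b ] , [ a ]))
      + (G ([ a ] , [ b ]) + eval (λ u → G (u , [])) (shuffle q [ a ] [ b ]))
eval-shuffleT-letters q G a b =
  trans (eval-bilinear (shuffle⊗ q) G (deconcatenation [ a ]) (deconcatenation [ b ]))
    (trans (eval-deconcatenation-letter
             (λ x → eval (λ y → eval G (shuffle⊗ q x y)) (deconcatenation [ b ])) a)
      (cong₂ _+_
        (trans (eval-deconcatenation-letter (λ y → eval G (shuffle⊗ q ([] , [ a ]) y)) b)
               (cong₂ _+_ (eval-tensor-basisˡ G [] (shuffle q [ a ] [ b ])) (eval-basis G ([ b ] , [ a ]))))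
        (trans (eval-deconcatenation-letter (λ y → eval G (shuffle⊗ q ([ a ] , []) y)) b)
               (cong₂ _+_ (eval-basis G ([ a ] , [ b ])) (eval-tensor-basisʳ G (shuffle q [ a ] [ b ]) [])))))

coeffT≡eval : ∀ T a b →
  coeffT T a b
    ≡ eval (λ (u , v) → if does (≡-dec ℕ._≟_ u a) ∧ does (≡-dec ℕ._≟_ v b) then + 1 else + 0) T
coeffT≡eval [] a b = refl
coeffT≡eval ((c , u , v) ∷ T) a b = cong₂ _+_ (if-scalar c _) (coeffT≡eval T a b)
  where
  if-scalar : ∀ c (t : Bool) → (if t then c else + 0) ≡ c * (if t then + 1 else + 0)
  if-scalar c true = sym (ℤ.*-identityʳ c)
  if-scalar c false = sym (ℤ.*-zeroʳ c)

module Modulo (p : ℕ) where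

  infix 4 _≈_ _≃_

  record _≈_ (x y : ℤ) : Set where
    constructor ≈-intro
    field p∣x-y : + p Signed.∣ x - y

  open _≈_

  private
    ∣-resp : ∀ {x y} → x ≡ y → + p Signed.∣ x → + p Signed.∣ y
    ∣-resp = subst (+ p Signed.∣_)

  ≈-refl : ∀ {x} → x ≈ x
  ≈-refl {x} = ≈-intro (divides (+ 0) (ℤ.+-inverseʳ x))

  ≡⇒≈ : ∀ {x y} → x ≡ y → x ≈ y
  ≡⇒≈ refl = ≈-refl

  ≈-sym : ∀ {x y} → x ≈ y → y ≈ x
  ≈-sym {x} {y} (≈-intro d) = ≈-intro (∣-resp (negate x y) (Signed.∣m⇒∣-m d))
    where
    negate : ∀ x y → - (x - y) ≡ y - x
    negate = solve-∀

  ≈-trans : ∀ {x y z} → x ≈ y → y ≈ z → x ≈ z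
  ≈-trans {x} {y} {z} (≈-intro d) (≈-intro e) =
    ≈-intro (∣-resp (telescope x y z) (Signed.∣m∣n⇒∣m+n d e))
    where
    telescope : ∀ x y z → (x - y) + (y - z) ≡ x - z
    telescope = solve-∀

  ≈-setoid : Setoid _ _
  ≈-setoid = record
    { Carrier = ℤ
    ; _≈_ = _≈_
    ; isEquivalence = record { refl = ≈-refl ; sym = ≈-sym ; trans = ≈-trans }
    }

  +-cong : ∀ {x y u v} → x ≈ y → u ≈ v → x + u ≈ y + v
  +-cong {x} {y} {u} {v} (≈-intro d) (≈-intro e) =
    ≈-intro (∣-resp (regroup x y u v) (Signed.∣m∣n⇒∣m+n d e))
    where
    regroup : ∀ x y u v → (x - y) + (u - v) ≡ (x + u) - (y + v)
    regroup = solve-∀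

  *-congˡ : ∀ c {x y} → x ≈ y → c * x ≈ c * y
  *-congˡ c {x} {y} (≈-intro d) = ≈-intro (∣-resp (distribute c x y) (Signed.∣n⇒∣m*n c d))
    where
    distribute : ∀ c x y → c * (x - y) ≡ c * x - c * y
    distribute = solve-∀

  ∣⇒≈0 : ∀ {x} → + p Signed.∣ x → x ≈ + 0
  ∣⇒≈0 {x} = ≈-intro ∘ ∣-resp (sym (ℤ.+-identityʳ x))

  eval-cong : ∀ {g h : A → ℤ} → (∀ x → g x ≈ h x) → ∀ L → eval g L ≈ eval h L
  eval-cong g≈h [] = ≈-refl
  eval-cong g≈h ((c , x) ∷ L) = +-cong (*-congˡ c (g≈h x)) (eval-cong g≈h L)

  record _≃_ (S T : List (ℤ × A)) : Set where
    constructor ≃-intro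
    field pointwise : ∀ g → eval g S ≈ eval g T

  open _≃_ public

  ≃-refl : ∀ {S : List (ℤ × A)} → S ≃ S
  ≃-refl = ≃-intro λ _ → ≈-refl

  ≃-setoid : Set → Setoid _ _
  ≃-setoid A = record
    { Carrier = List (ℤ × A)
    ; _≈_ = _≃_
    ; isEquivalence = record
      { refl = ≃-refl
      ; sym = λ S≃T → ≃-intro λ g → ≈-sym (pointwise S≃T g)
      ; trans = λ S≃T T≃U → ≃-intro λ g → ≈-trans (pointwise S≃T g) (pointwise T≃U g)
      }
    }

  ++-cong : ∀ {S S' T T' : List (ℤ × A)} → S ≃ S' → T ≃ T' → S ++ T ≃ S' ++ T'
  ++-cong {S = S} {S'} {T} {T'} S≃S' T≃T' = ≃-intro λ g →
    ≈-trans (≡⇒≈ (eval-++ g S T))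
      (≈-trans (+-cong (pointwise S≃S' g) (pointwise T≃T' g)) (≡⇒≈ (sym (eval-++ g S' T'))))

  scaleT-cong : ∀ c {S T} → S ≃ T → scaleT c S ≃ scaleT c T
  scaleT-cong c {S} {T} S≃T = ≃-intro λ G →
    ≈-trans (≡⇒≈ (eval-scaleT G c S))
      (≈-trans (*-congˡ c (pointwise S≃T G)) (≡⇒≈ (sym (eval-scaleT G c T))))

  bilinear-cong : ∀ K {S S' T T'} → S ≃ S' → T ≃ T' → bilinear K S T ≃ bilinear K S' T'
  bilinear-cong K {S} {S'} {T} {T'} S≃S' T≃T' = ≃-intro λ G →
    ≈-trans (≡⇒≈ (eval-bilinear K G S T))
      (≈-trans (pointwise S≃S' _)
        (≈-trans (eval-cong (λ x → pointwise T≃T' (λ y → eval G (K x y))) S')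
          (≡⇒≈ (sym (eval-bilinear K G S' T')))))

  concatMap-≃[] : ∀ {f : ℕ → List (ℤ × A)} {L} → All (λ j → f j ≃ []) L → concatMap f L ≃ []
  concatMap-≃[] [] = ≃-refl
  concatMap-≃[] {f = f} {j ∷ L} (fj≃[] ∷ rest) = ≃-intro λ g →
    ≈-trans (≡⇒≈ (eval-++ g (f j) (concatMap f L)))
      (+-cong (pointwise fj≃[] g) (pointwise (concatMap-≃[] rest) g))

  scale-≃[] : ∀ {c} → + p Signed.∣ c → ∀ L → scale c L ≃ []
  scale-≃[] {c} p∣c L = ≃-intro λ g →
    ≈-trans (≡⇒≈ (eval-scale g c L)) (∣⇒≈0 (Signed.∣m⇒∣m*n (eval g L) p∣c))

  scaleT-≃[] : ∀ {c} → + p Signed.∣ c → ∀ T → scaleT c T ≃ []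
  scaleT-≃[] {c} p∣c T = ≃-intro λ G →
    ≈-trans (≡⇒≈ (eval-scaleT G c T)) (∣⇒≈0 (Signed.∣m⇒∣m*n (eval G T) p∣c))

  cancel : ∀ {S T R} → S ≃ T ++ R → S ++ negT T ≃ R
  cancel {S} {T} {R} S≃T++R = ≃-intro λ G →
    ≈-trans (≡⇒≈ (trans (eval-++ G S (negT T)) (cong (_+_ (eval G S)) (eval-scaleT G (- (+ 1)) T))))
      (≈-trans (+-cong (≈-trans (pointwise S≃T++R G) (≡⇒≈ (eval-++ G T R))) ≈-refl)
        (≡⇒≈ (difference (eval G T) (eval G R))))
    where
    difference : ∀ t r → (t + r) + - (+ 1) * t ≡ r
    difference = solve-∀

  ≃⇒≈[] : ∀ {S T} → S ≃ T → S ≈[ p ] T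
  ≃⇒≈[] {S} {T} S≃T a b =
    ∣⇒∣ᵤ (subst (λ t → + p Signed.∣ t)
                (sym (cong₂ _-_ (coeffT≡eval S a b) (coeffT≡eval T a b)))
                (p∣x-y (pointwise S≃T _)))

sgn-parity : ∀ k → (sgn k ≡ - (+ 1) × 2 ∣ suc k) ⊎ (sgn k ≡ + 1 × 2 ∣ k)
sgn-parity zero = inj₂ (refl , 2 ∣0)
sgn-parity (suc k) with sgn-parity k
... | inj₁ (sgn≡-1 , 2∣1+k) = inj₂ (cong -_ sgn≡-1 , 2∣1+k)
... | inj₂ (sgn≡1 , 2∣k) = inj₁ (cong -_ sgn≡1 , ∣m∣n⇒∣m+n ∣-refl 2∣k)

if-does-∧-elim : ∀ (P : ℤ → Set) {A : Set} (a? : Dec A) {b : Bool} {v : ℤ} →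
  (A → P v) → P (+ 0) → P (if does a? ∧ b then v else + 0)
if-does-∧-elim P (yes a) {true} Pv P0 = Pv a
if-does-∧-elim P (yes a) {false} Pv P0 = P0
if-does-∧-elim P (no _) Pv P0 = P0

-- Δ^{j+1}_{1,j+1} = 1 + (-1)^j.
Dlt-diagonal-vanishes : ∀ {p} j → (2 ∣ j → p ∣ 2) →
  + p Signed.∣ (sgn 0 * + (j C 0) + sgn j * + (j C j))
Dlt-diagonal-vanishes j even⇒p∣2 rewrite nCn≡1 j with sgn-parity j
... | inj₁ (sgn≡-1 , _) rewrite sgn≡-1 = divides (+ 0) refl
... | inj₂ (sgn≡1 , 2∣j) rewrite sgn≡1 = ∣ᵤ⇒∣ (even⇒p∣2 2∣j)

Dlt-1-vanishes : ∀ {p q j m} → (2 ∣ q → p ∣ 2) → j < m → m < q → + p Signed.∣ Dlt q (suc j) 1 m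
Dlt-1-vanishes {p} {suc q'} {j} {m} even⇒p∣2 j<m m<q =
  if-does-∧-elim (+ p Signed.∣_) (q' ∣? suc j) at-j≡q-1 (divides (+ 0) refl)
  where
  at-j≡q-1 : q' ∣ suc j → + p Signed.∣ (sgn 0 * + (j C 0) + sgn (m ∸ 1) * + (j C (m ∸ 1)))
  at-j≡q-1 q'∣1+j =
    subst (λ k → + p Signed.∣ (sgn 0 * + (j C 0) + sgn (k ∸ 1) * + (j C (k ∸ 1)))) (sym m≡1+j)
      (Dlt-diagonal-vanishes j (even⇒p∣2 ∘ 2∣j⇒2∣q))
    where
    m≡1+j : m ≡ suc j
    m≡1+j = ≤-antisym (≤-trans (≤-pred m<q) (∣⇒≤ q'∣1+j)) j<m
    q'≡1+j : q' ≡ suc j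
    q'≡1+j = ≤-antisym (∣⇒≤ q'∣1+j) (≤-trans j<m (≤-pred m<q))
    2∣j⇒2∣q : 2 ∣ j → 2 ∣ suc q'
    2∣j⇒2∣q 2∣j = subst (λ n → 2 ∣ suc n) (sym q'≡1+j) (∣m∣n⇒∣m+n ∣-refl 2∣j)

2∣p^n⇒p∣2 : ∀ {p} → Prime p → ∀ n → 2 ∣ p ^ n → p ∣ 2
2∣p^n⇒p∣2 {p} prime-p zero 2∣1 with () ← ∣1⇒≡1 2∣1
2∣p^n⇒p∣2 {p} prime-p (suc n) 2∣p^[1+n] with euclidsLemma p (p ^ n) prime[2] 2∣p^[1+n]
... | inj₁ 2∣p = ∣-reflexive ([ (λ ()) , sym ]′ (prime⇒irreducible prime-p 2∣p))
... | inj₂ 2∣p^n = 2∣p^n⇒p∣2 prime-p n 2∣p^n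

module PrimitiveLetters (p q : ℕ) (even⇒p∣2 : 2 ∣ q → p ∣ 2) where

  open Modulo p

  eval-shuffle-x₁ : ∀ {m} → m < q → ∀ (g : Word → ℤ) →
    eval g (shuffle q [ 1 ] [ m ]) ≈ g (1 ∷ m ∷ []) + (g (m ∷ 1 ∷ []) + g [ suc m ])
  eval-shuffle-x₁ {m} m<q g = begin
    eval g (L ++ D)          ≡⟨ eval-++ g L D ⟩
    eval g L + eval g D      ≈⟨ +-cong (≈-refl {eval g L}) D≃[] ⟩
    eval g L + + 0           ≡⟨ ℤ.+-identityʳ _ ⟩
    eval g L                 ≡⟨ cong₂ _+_ (ℤ.*-identityˡ (g (1 ∷ m ∷ [])))
                                  (cong₂ _+_ (ℤ.*-identityˡ (g (m ∷ 1 ∷ []))) (eval-basis g [ suc m ])) ⟩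
    g (1 ∷ m ∷ []) + (g (m ∷ 1 ∷ []) + g [ suc m ]) ∎
    where
    open SetoidReasoning ≈-setoid
    summand : ℕ → Lin
    summand j = pre (suc m ∸ j) (shLetterL q 1 j (basis []))
    L D : Lin
    L = basis (1 ∷ m ∷ []) ++ basis (m ∷ 1 ∷ []) ++ basis [ suc m ]
    D = sumL (λ j → scale (Dlt q j 1 m) (summand j)) (suc m)
    D≃[] : eval g D ≈ + 0
    D≃[] = pointwise (concatMap-≃[] (applyUpTo⁺₁ id m λ {i} i<m →
      scale-≃[] (Dlt-1-vanishes even⇒p∣2 i<m m<q) (summand (suc i)))) g

  shuffle-x₁-deconcatenation : ∀ {m} → m < q →
    shuffleT q (deconcatenation [ 1 ]) (deconcatenation [ m ])
      ≃ (deconcatenation (1 ∷ m ∷ []) ++ deconcatenation (m ∷ 1 ∷ [])) ++ deconcatenation [ suc m ]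
  shuffle-x₁-deconcatenation {m} m<q = ≃-intro expand
    where
    expand : ∀ G → eval G (shuffleT q (deconcatenation [ 1 ]) (deconcatenation [ m ]))
      ≈ eval G ((deconcatenation (1 ∷ m ∷ []) ++ deconcatenation (m ∷ 1 ∷ [])) ++ deconcatenation [ suc m ])
    expand G = begin
      eval G (shuffleT q (deconcatenation [ 1 ]) (deconcatenation [ m ]))
        ≡⟨ eval-shuffleT-letters q G 1 m ⟩
      (eval (λ v → G ([] , v)) (shuffle q [ 1 ] [ m ]) + c)
        + (d + eval (λ u → G (u , [])) (shuffle q [ 1 ] [ m ]))
        ≈⟨ +-cong (+-cong (eval-shuffle-x₁ m<q (λ v → G ([] , v))) (≈-refl {c}))
                  (+-cong (≈-refl {d}) (eval-shuffle-x₁ m<q (λ u → G (u , [])))) ⟩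
      ((s₁ + (s₂ + s₃)) + c) + (d + (t₁ + (t₂ + t₃)))
        ≡⟨ regroup s₁ s₂ s₃ t₁ t₂ t₃ c d ⟩
      ((s₁ + (d + t₁)) + (s₂ + (c + t₂))) + (s₃ + t₃)
        ≡⟨ sym (cong₂ _+_ (cong₂ _+_ (eval-deconcatenation-pair G 1 m) (eval-deconcatenation-pair G m 1))
                          (eval-deconcatenation-letter G (suc m))) ⟩
      (eval G P + eval G Q) + eval G (deconcatenation [ suc m ])
        ≡⟨ sym (trans (eval-++ G (P ++ Q) (deconcatenation [ suc m ]))
                      (cong (_+ eval G (deconcatenation [ suc m ])) (eval-++ G P Q))) ⟩
      eval G ((deconcatenation (1 ∷ m ∷ []) ++ deconcatenation (m ∷ 1 ∷ [])) ++ deconcatenation [ suc m ]) ∎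
      where
      open SetoidReasoning ≈-setoid
      P Q : Ten
      P = deconcatenation (1 ∷ m ∷ [])
      Q = deconcatenation (m ∷ 1 ∷ [])
      s₁ = G ([] , 1 ∷ m ∷ [])
      s₂ = G ([] , m ∷ 1 ∷ [])
      s₃ = G ([] , [ suc m ])
      t₁ = G (1 ∷ m ∷ [] , [])
      t₂ = G (m ∷ 1 ∷ [] , [])
      t₃ = G ([ suc m ] , [])
      c = G ([ m ] , [ 1 ])
      d = G ([ 1 ] , [ m ])
      regroup : ∀ s₁ s₂ s₃ t₁ t₂ t₃ c d →
        ((s₁ + (s₂ + s₃)) + c) + (d + (t₁ + (t₂ + t₃)))
          ≡ ((s₁ + (d + t₁)) + (s₂ + (c + t₂))) + (s₃ + t₃)
      regroup = solve-∀

  cop-pair : ∀ {f a b} →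
    cop q f [ a ] ≃ deconcatenation [ a ] → cop q f [ b ] ≃ deconcatenation [ b ] →
    cop q (suc f) (a ∷ b ∷ []) ≃ deconcatenation (a ∷ b ∷ [])
  cop-pair {f} {a} {b} Δa Δb = begin
    cop q (suc f) (a ∷ b ∷ [])
      ≡⟨ cop-pair-unfold q f a b ⟩
    basis ([] , a ∷ b ∷ []) ++ combine q (cop q f [ a ] ++ negT (basis ([] , [ a ]))) (cop q f [ b ])
      ≈⟨ ++-cong ≃-refl (bilinear-cong (triangle⊗ q) (cancel Δa) Δb) ⟩
    basis ([] , a ∷ b ∷ []) ++ combine q (basis ([ a ] , [])) (deconcatenation [ b ])
      ≡⟨⟩
    deconcatenation (a ∷ b ∷ []) ∎
    where open SetoidReasoning (≃-setoid (Word × Word))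

  cop-letter-step : ∀ {k f} → suc k < q →
    cop q (suc (suc f)) [ suc k ] ≃ deconcatenation [ suc k ] →
    cop q (suc f) [ suc k ] ≃ deconcatenation [ suc k ] →
    cop q (suc (suc (suc f))) [ suc (suc k) ] ≃ deconcatenation [ suc (suc k) ]
  cop-letter-step {k} {f} m<q Δm Δm′ = begin
    cop q (suc F) [ n ]
      ≡⟨⟩
    shuffleT q (cop q F [ 1 ]) (cop q F [ m ])
      ++ negT (cop q F (1 ∷ m ∷ [])) ++ negT (cop q F (m ∷ 1 ∷ [])) ++ negT D
      ≈⟨ ++-cong {S = shuffleT q (cop q F [ 1 ]) (cop q F [ m ])}
           (bilinear-cong (shuffle⊗ q) {S = cop q F [ 1 ]} {T = cop q F [ m ]} ≃-refl Δm)
           (++-cong {S = negT (cop q F (1 ∷ m ∷ []))}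
             (scaleT-cong (- (+ 1)) (cop-pair {suc f} {1} ≃-refl Δm′))
             (++-cong (scaleT-cong (- (+ 1)) (cop-pair {suc f} {m} {1} Δm′ ≃-refl))
                      (scaleT-cong (- (+ 1)) D≃[]))) ⟩
    shuffleT q (deconcatenation [ 1 ]) (deconcatenation [ m ]) ++ negT P ++ negT Q ++ []
      ≡⟨ cong (shuffleT q (deconcatenation [ 1 ]) (deconcatenation [ m ]) ++_)
              (trans (cong (negT P ++_) (++-identityʳ (negT Q))) (sym (scaleT-++ (- (+ 1)) P Q))) ⟩
    shuffleT q (deconcatenation [ 1 ]) (deconcatenation [ m ]) ++ negT (P ++ Q)
      ≈⟨ cancel (shuffle-x₁-deconcatenation m<q) ⟩
    deconcatenation [ n ] ∎
    where
    open SetoidReasoning (≃-setoid (Word × Word))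
    m n F : ℕ
    m = suc k
    n = suc m
    F = suc (suc f)
    P Q D : Ten
    P = deconcatenation (1 ∷ m ∷ [])
    Q = deconcatenation (m ∷ 1 ∷ [])
    D = sumT (λ j → scaleT (Dlt q j 1 m) (cop q F ((n ∸ j) ∷ j ∷ []))) n
    D≃[] : D ≃ []
    D≃[] = concatMap-≃[] (applyUpTo⁺₁ id m λ {i} i<m →
      scaleT-≃[] (Dlt-1-vanishes even⇒p∣2 i<m m<q) (cop q F ((n ∸ suc i) ∷ suc i ∷ [])))

  -- cop consumes one unit of fuel per recursive call, so x_n needs 2n - 1 units;
  -- the bound is written n * 2 so that the leading sucs of n * 2 reduce.
  cop-letter : ∀ n → 1 ≤ n → n ≤ q → ∀ {f} → n ℕ.* 2 ≤ suc f →
    cop q f [ n ] ≃ deconcatenation [ n ]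
  cop-letter 1 _ _ {zero} (s≤s ())
  cop-letter 1 _ _ {suc f} _ = ≃-refl
  cop-letter (suc (suc k)) _ _ {zero} (s≤s ())
  cop-letter (suc (suc k)) _ _ {1} (s≤s (s≤s ()))
  cop-letter (suc (suc k)) _ _ {2} (s≤s (s≤s (s≤s ())))
  cop-letter (suc (suc k)) _ n≤q {suc (suc (suc f))} (s≤s (s≤s (s≤s (s≤s 2k≤f)))) =
    cop-letter-step n≤q
      (cop-letter (suc k) (s≤s z≤n) (<⇒≤ n≤q) (s≤s (s≤s (m≤n⇒m≤1+n 2k≤f))))
      (cop-letter (suc k) (s≤s z≤n) (<⇒≤ n≤q) (s≤s (s≤s 2k≤f)))

proposition8p12 : (p k : ℕ) → Prime p → (n : ℕ) → 1 ≤ n → n ≤ p ^ suc k →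
    coproduct (p ^ suc k) [ n ] ≈[ p ] ((+ 1 , [] , [ n ]) ∷ (+ 1 , [ n ] , []) ∷ [])
proposition8p12 p k prime-p n 1≤n n≤q =
  ≃⇒≈[] (cop-letter n 1≤n n≤q enough-fuel)
  where
  open Modulo p
  open PrimitiveLetters p (p ^ suc k) (2∣p^n⇒p∣2 prime-p (suc k))
  enough-fuel : n ℕ.* 2 ≤ suc (2 ℕ.* weight [ n ] ℕ.+ 1 ℕ.+ 1)
  enough-fuel =
    ≤-trans (≤-reflexive (trans (*-comm n 2) (cong (2 ℕ.*_) (sym (+-identityʳ n)))))
      (m≤n⇒m≤1+n (≤-trans (m≤m+n _ 1) (m≤m+n _ 1)))
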